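{- Let $\mathbf{O}$ be a decent class of operators. Then all constant functions in $\mathbb{T}_1$ and all the functions $\delta_K$, $K=0,1,2,\ldots$, are $\mathbf{O}$-representable.
   Context: $\mathbb{T}_m$ is the set of total functions $\mathbb{N}^m\to\mathbb{N}$; a $k$-ary operator is a map $\mathbb{T}_1^k\to\mathbb{T}_1$; $\check{c}\in\mathbb{T}_1$ is the constant function with value $c$. A class $\mathbf{O}$ of operators is appropriate if: (1) for all $k$ and $i\le k$ the operator $(f_1,\ldots,f_k)\mapsto f_i$ is in $\mathbf{O}$; (2) the operator $F(f_1,f_2)(n)=f_1(f_2(n))$ is in $\mathbf{O}$; (3) if $F$ is $k$-ary in $\mathbf{O}$ and $G_1,\ldots,G_k$ are $l$-ary in $\mathbf{O}$, then $H(g_1,\ldots,g_l)=F(G_1(g_1,\ldots,g_l),\ldots,G_k(g_1,\ldots,g_l))$ is in $\mathbf{O}$; (4) if $F$ is $(k+1)$-ary in $\mathbf{O}$, then $G(f_1,\ldots,f_k)(n)=F(f_1,\ldots,f_k,\check{n})(n)$ is in $\mathbf{O}$. For $f:\mathbb{N}^r\to\mathbb{N}$, $\mathring{f}(f_1,\ldots,f_r)(n)=f(f_1(n),\ldots,f_r(n))$; $f$ is $\mathbf{O}$-representable if $\mathring{f}\in\mathbf{O}$. For $K\in\mathbb{N}$, $\delta_K\in\mathbb{T}_{2K+1}$ is defined by: $\delta_K(x_1,y_1,\ldots,x_K,y_K,z)=y_i$ for the least $i\in\{1,\ldots,K\}$ with $x_i=0$ if such $i$ exists, and $=z$ otherwise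 (so $\delta_1(x,y,z)=y$ if $x=0$, $z$ otherwise; $\delta_0(z)=z$). $\mathbf{O}$ is decent if it is appropriate and $\lambda x.x+1$, $\lambda xy.x\dotminus y$ (truncated subtraction) and $\delta_1$ are $\mathbf{O}$-representable. -}

module Defs where

open import Data.Nat using (ℕ; zero; suc; _+_; _∸_)
open import Data.Fin using (Fin; zero; suc)
open import Relation.Binary.PropositionalEquality using (_≡_)

𝕋 : ℕ → Set
𝕋 m = (Fin m → ℕ) → ℕ

𝕋₁ : Set
𝕋₁ = ℕ → ℕ

Operator : ℕ → Set
Operator k = (Fin k → 𝕋₁) → 𝕋₁

-- a class of operators: a predicate on operators of each arity.
-- Since operators are (set-theoretic, hence extensional) functions,
-- membership must respect pointwise equality of operators.
record OpClass : Set₁ where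
  field
    mem : (k : ℕ) → Operator k → Set
    ext : ∀ {k} (F G : Operator k) →
          (∀ (fs : Fin k → 𝕋₁) (n : ℕ) → F fs n ≡ G fs n) →
          mem k F → mem k G
open OpClass public

consť : ℕ → 𝕋₁
consť c _ = c

snoc : ∀ {k} {A : Set} → (Fin k → A) → A → Fin (suc k) → A
snoc {zero}  fs a zero    = a
snoc {suc k} fs a zero    = fs zero
snoc {suc k} fs a (suc i) = snoc (λ j → fs (suc j)) a i

record Appropriate (O : OpClass) : Set where
  field
    proj : ∀ k (i : Fin k) → mem O k (λ fs → fs i)
    comp : mem O 2 (λ fs n → fs zero (fs (suc zero) n))
    subst : ∀ k l (F : Operator k) (Gs : Fin k → Operator l) →
            mem O k F → (∀ i → mem O l (Gs i)) →
            mem O l (λ gs → F (λ i → Gs i gs))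
    diag : ∀ k (F : Operator (suc k)) → mem O (suc k) F →
           mem O k (λ fs n → F (snoc fs (consť n)) n)

ring : ∀ {r} → 𝕋 r → Operator r
ring f fs n = f (λ i → fs i n)

Representable : OpClass → ∀ {r} → 𝕋 r → Set
Representable O {r} f = mem O r (ring f)

δ₁ : ℕ → ℕ → ℕ → ℕ
δ₁ zero    y z = y
δ₁ (suc _) y z = z

ar : ℕ → ℕ
ar zero    = 1
ar (suc K) = suc (suc (ar K))

-- δ_K(x₁,y₁,…,x_K,y_K,z): argument order x₁,y₁,x₂,y₂,…,z
δ : (K : ℕ) → 𝕋 (ar K)
δ zero    v = v zero
δ (suc K) v = δ₁ (v zero) (v (suc zero)) (δ K (λ i → v (suc (suc i))))

succ𝕋 : 𝕋 1
succ𝕋 v = suc (v zero)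

monus𝕋 : 𝕋 2
monus𝕋 v = v zero ∸ v (suc zero)

δ₁𝕋 : 𝕋 3
δ₁𝕋 v = δ₁ (v zero) (v (suc zero)) (v (suc (suc zero)))

record Decent (O : OpClass) : Set where
  field
    appropriate : Appropriate O
    rep-suc   : Representable O succ𝕋
    rep-monus : Representable O monus𝕋
    rep-δ₁    : Representable O δ₁𝕋

const𝕋 : ℕ → 𝕋 1
const𝕋 c _ = c

module Submission where

-- Representability is closed under the operations a clone
-- is closed under: every coordinate projection is representable
-- (axiom (1)), and substituting representable functions into a
-- representable function gives a representable function (axiom (3),
-- because f̊ applied to g̊₁,…,g̊ᵣ is exactly the operator of the
-- composite).  Representability also only depends on the function up to
-- pointwise equality.  For a decent class this gives
--   * 0 = x ∸ x, and c + 1 = succ(c), so by induction every constant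
--     function of one variable is representable;
--   * δ₀ is the projection onto z, and
--     δ_{K+1}(x₁,y₁,…,z) = δ₁(x₁, y₁, δ_K(x₂,y₂,…,z)), so by induction
--     on K every δ_K is representable.

open import Defs
open import Data.Nat using (ℕ; zero; suc; _∸_)
open import Data.Nat.Properties using (n∸n≡0)
open import Data.Fin using (Fin; zero; suc)
open import Data.Product using (_×_; _,_)
open import Relation.Binary.PropositionalEquality using (_≡_)

module Closure (O : OpClass) (A : Appropriate O) where
  open Appropriate A

  projection-representable : ∀ {r} (i : Fin r) → Representable O {r} (λ v → v i)
  projection-representable {r} i = proj r i

  substitution-representable : ∀ {r s} (f : 𝕋 r) (gs : Fin r → 𝕋 s) →
    Representable O f → (∀ i → Representable O (gs i)) →
    Representable O (λ v → f (λ i → gs i v))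
  substitution-representable {r} {s} f gs f-rep gs-rep =
    subst r s (ring f) (λ i → ring (gs i)) f-rep gs-rep

  representable-resp : ∀ {r} (f g : 𝕋 r) → (∀ v → f v ≡ g v) →
    Representable O f → Representable O g
  representable-resp f g f≗g = ext O (ring f) (ring g) (λ fs n → f≗g (λ i → fs i n))

module _ (O : OpClass) (D : Decent O) where
  open Decent D
  open Closure O appropriate

  zero-representable : Representable O (const𝕋 0)
  zero-representable =
    representable-resp (λ v → v zero ∸ v zero) (const𝕋 0) (λ v → n∸n≡0 (v zero))
      (substitution-representable monus𝕋 (λ _ v → v zero) rep-monus
        (λ _ → projection-representable zero))

  const-representable : ∀ c → Representable O (const𝕋 c)
  const-representable zero    = zero-representable
  const-representable (suc c) =
    substitution-representable succ𝕋 (λ _ → const𝕋 c) rep-suc (λ _ → const-representable c)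

  δ-representable : ∀ K → Representable O (δ K)
  δ-representable zero    = projection-representable zero
  δ-representable (suc K) =
    substitution-representable δ₁𝕋 arguments rep-δ₁ arguments-representable
    where
      arguments : Fin 3 → 𝕋 (ar (suc K))
      arguments zero             v = v zero
      arguments (suc zero)       v = v (suc zero)
      arguments (suc (suc zero)) v = δ K (λ i → v (suc (suc i)))

      arguments-representable : ∀ i → Representable O (arguments i)
      arguments-representable zero             = projection-representable zero
      arguments-representable (suc zero)       = projection-representable (suc zero)
      arguments-representable (suc (suc zero)) =
        substitution-representable (δ K) (λ i v → v (suc (suc i))) (δ-representable K)
          (λ i → projection-representable (suc (suc i)))

lemma9 : (O : OpClass) → Decent O →
    (∀ (c : ℕ) → Representable O (const𝕋 c)) × (∀ (K : ℕ) → Representable O (δ K))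
lemma9 O D = const-representable O D , δ-representable O D
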